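{- Let $G_{\mathcal I}=(V,E)$ be the graph constructed below from a $\mathrm{GT}_\le$ instance $\mathcal I$. Then for every vertex $v\in V$ we have $\min_{(i,j)\in[\chi]^2}\mathrm{dist}(v,y_{i,j})\le 2^{n+2}+2^{n+1}$.
   Context: Grid Tiling with Inequality ($\mathrm{GT}_\le$): an instance $\mathcal I$ consists of integers $\chi,n$ and sets $S_{i,j}\subseteq[n]^2$ for $(i,j)\in[\chi]^2$; it asks whether one can choose $s_{i,j}\in S_{i,j}$ for all $(i,j)$ such that whenever $s_{i,j}=(a,b)$ and $s_{i+1,j}=(a',b')$ we have $a\le a'$, and whenever $s_{i,j}=(a,b)$ and $s_{i,j+1}=(a',b')$ we have $b\le b'$. Standing assumption: for every $(i,j)$ and every $b\in[n]$ there is $a\in[n]$ with $(a,b)\in S_{i,j}$. Pairs are ordered lexicographically: $(a,b)\le(a',b')$ iff $a<a'$, or $a=a'$ and $b\le b'$. $\boxplus$ denotes addition modulo 4 on $\{1,2,3,4\}$ (so $4\boxplus1=1$). $\mathrm{dist}$ denotes shortest-path distance. Construction of the edge-weighted graph $G_{\mathcal I}$. For each $(i,j)\in[\chi]^2$ there is a gadget $G_{i,j}$ (in what follows the subscript $i,j$ is suppressed inside a gadget): a cycle $O_{i,j}$ through four vertices $z^1,z^2,z^3,z^4$ in this cyclic order, where the segment $O^h$ from $z^h$ to $z^{h\boxplus1}$ is a path of total length $2^{n+2}+1/n$. For each $(a,b)\in S_{i,j}$ and $h\in[4]$, the path $O^h$ contains a vertex $v^h_{(a,b)}$ at distance $d_{(a,b)}=2^b-1+a/n$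 from $z^h$, and vertices $\psi^h_{(a,b)},\psi'^h_{(a,b)}$ at distance $2^{n+1}$ and $2^{n+1}+1/n$ from $v^h_{(a,b)}$ towards $z^{h\boxplus1}$; $O^h$ is the path through all these points in order of their distance from $z^h$, each edge having length equal to the difference of positions. A central vertex $y$ is joined to each $z^h$ by an edge of length $2^{n+1}+1$. There are four further vertices $x^1,\dots,x^4$. Let $(a^*,b^*)=\min S_{i,j}$ (lexicographic). Add edge $\{x^2,v^2_{(a^*,b^*)}\}$ of length $2^n+2^{b^*}+a^*/n$ and edge $\{x^4,v^4_{(a^*,b^*)}\}$ of length $2^{n+1}+1-2^{b^*}-a^*/n$. For $h\in\{1,3\}$ add a path $U^h=u^h_1u^h_2\cdots u^h_n$ with edge $\{u^h_\lambda,u^h_{\lambda+1}\}$ of length $2^\lambda$, and an edge $\{u^h_n,x^h\}$ of length $2^n$. For $b\in[n]$: the $b$-portal $\rho^1_b$ is $v^1_{(\alpha,b)}$ with $\alpha$ the largest value such that $(\alpha,b)\in S_{i,j}$, joined to $u^1_b$ by a portal edge of length $2^b-\alpha/n$; the $b$-portal $\rho^3_b$ is $v^3_{(\alpha,b)}$ with $\alpha$ the smallest value such that $(\alpha,b)\in S_{i,j}$, joined to $u^3_b$ by a portal edge of length $2^b-1+\alpha/n$. Gadgets are connected as follows: for $i\in[\chi-1]$, $j\in[\chi]$, a path $P_{i,j}$ from $x^3_{i,j}$ to $x^1_{i+1,j}$ consisting of $n+1$ edges of length $1/(n+1)$; for $i\in[\chi]$, $j\in[\chi-1]$, a path $P'_{i,j}=w_1\cdots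 w_n$ with $w_1=x^4_{i,j+1}$, $w_n=x^2_{i,j}$ and edge $\{w_\lambda,w_{\lambda+1}\}$ of length $2^\lambda$. -}

module Defs where

open import Data.Nat as ℕ using (ℕ; zero; suc; NonZero; _^_; _∸_)
open import Data.Integer using (+_)
open import Data.Rational using (ℚ; _/_; _+_; _-_; _≤_; _<_; 0ℚ)
open import Data.Fin using (Fin; toℕ)
open import Data.Bool using (Bool; true)
open import Data.Product using (_×_; ∃; proj₁)
open import Data.Sum using (_⊎_)
open import Relation.Binary.PropositionalEquality using (_≡_)
open import Relation.Nullary using (¬_)

-- A GT_≤ instance.  [n] is represented by Fin n, with a : Fin n standing
-- for the integer suc (toℕ a) ∈ {1,…,n}.  The sets S_{i,j} ⊆ [n]^2 are
-- given by their (decidable) characteristic functions.  n ≥ 1 is needed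
-- for the construction (a/n, min S_{i,j}).
record GTInstance : Set where
  field
    χ n : ℕ
    {{n≢0}} : NonZero n
    S : Fin χ → Fin χ → Fin n → Fin n → Bool

Standing : GTInstance → Set
Standing I = ∀ i j b → ∃ λ a → S i j a b ≡ true
  where open GTInstance I

data H : Set where
  h1 h2 h3 h4 : H

next : H → H
next h1 = h2
next h2 = h3
next h3 = h4
next h4 = h1

-- the two indices h ∈ {1,3} that carry a path U^h
data H13 : Set where
  one three : H13

x-of : H13 → H
x-of one = h1
x-of three = h3

module Construction (I : GTInstance) where
  open GTInstance I

  val : Fin n → ℕ
  val a = suc (toℕ a)

  Mem : Fin χ → Fin χ → Fin n → Fin n → Set
  Mem i j a b = S i j a b ≡ true

  -- vertices of G_I.  p: internal vertices of P_{i,j} (i' = i+1);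
  -- w: the vertices w_1..w_n of P'_{i,j} (j' = j+1).
  data Vtx : Set where
    z : (i j : Fin χ) → H → Vtx
    y : (i j : Fin χ) → Vtx
    x : (i j : Fin χ) → H → Vtx
    v : (i j : Fin χ) → H → (a b : Fin n) → Mem i j a b → Vtx
    ψ : (i j : Fin χ) → H → (a b : Fin n) → Mem i j a b → Vtx
    ψ' : (i j : Fin χ) → H → (a b : Fin n) → Mem i j a b → Vtx
    u : (i j : Fin χ) → H13 → Fin n → Vtx
    p : (i i' j : Fin χ) → toℕ i' ≡ suc (toℕ i) → Fin n → Vtx
    w : (i j j' : Fin χ) → toℕ j' ≡ suc (toℕ j) → Fin n → Vtx

  ⌜_⌝ : ℕ → ℚ
  ⌜ k ⌝ = + k / 1

  fr : ℕ → ℚ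
  fr k = + k / n

  d : Fin n → Fin n → ℚ
  d a b = ⌜ 2 ^ val b ∸ 1 ⌝ + fr (val a)

  -- the points on a segment O^h of the cycle of gadget (i,j)
  data OPt (i j : Fin χ) : Set where
    start end : OPt i j
    pv pψ pψ' : (a b : Fin n) → Mem i j a b → OPt i j

  -- position (distance from z^h) of a point on O^h
  pos : ∀ {i j} → OPt i j → ℚ
  pos start = 0ℚ
  pos end = ⌜ 2 ^ (n ℕ.+ 2) ⌝ + fr 1
  pos (pv a b _) = d a b
  pos (pψ a b _) = d a b + ⌜ 2 ^ (n ℕ.+ 1) ⌝
  pos (pψ' a b _) = d a b + ⌜ 2 ^ (n ℕ.+ 1) ⌝ + fr 1

  onO : ∀ i j → H → OPt i j → Vtx
  onO i j h start = z i j h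
  onO i j h end = z i j (next h)
  onO i j h (pv a b m) = v i j h a b m
  onO i j h (pψ a b m) = ψ i j h a b m
  onO i j h (pψ' a b m) = ψ' i j h a b m

  LexLe : Fin n → Fin n → Fin n → Fin n → Set
  LexLe a b a' b' = toℕ a ℕ.< toℕ a' ⊎ (a ≡ a' × toℕ b ℕ.≤ toℕ b')

  IsMinS : Fin χ → Fin χ → Fin n → Fin n → Set
  IsMinS i j a b = Mem i j a b × (∀ a' b' → Mem i j a' b' → LexLe a b a' b')

  IsMaxα : Fin χ → Fin χ → Fin n → Fin n → Set
  IsMaxα i j α b = Mem i j α b × (∀ α' → Mem i j α' b → toℕ α' ℕ.≤ toℕ α)

  IsMinα : Fin χ → Fin χ → Fin n → Fin n → Set
  IsMinα i j α b = Mem i j α b × (∀ α' → Mem i j α' b → toℕ α ℕ.≤ toℕ α')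

  data Edge : Vtx → Vtx → ℚ → Set where
    e-yz : ∀ i j h → Edge (y i j) (z i j h) ⌜ 2 ^ (n ℕ.+ 1) ℕ.+ 1 ⌝
    e-O : ∀ i j h (q r : OPt i j) → pos q ≤ pos r
          → (∀ (t : OPt i j) → ¬ (pos q < pos t × pos t < pos r))
          → Edge (onO i j h q) (onO i j h r) (pos r - pos q)
    e-x2 : ∀ i j a b (m : IsMinS i j a b)
           → Edge (x i j h2) (v i j h2 a b (proj₁ m)) (⌜ 2 ^ n ℕ.+ 2 ^ val b ⌝ + fr (val a))
    e-x4 : ∀ i j a b (m : IsMinS i j a b)
           → Edge (x i j h4) (v i j h4 a b (proj₁ m))
                  (⌜ 2 ^ (n ℕ.+ 1) ℕ.+ 1 ⌝ - ⌜ 2 ^ val b ⌝ - fr (val a))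
    e-U : ∀ i j k (l l' : Fin n) → toℕ l' ≡ suc (toℕ l)
          → Edge (u i j k l) (u i j k l') ⌜ 2 ^ val l ⌝
    e-Ux : ∀ i j k (l : Fin n) → val l ≡ n
           → Edge (u i j k l) (x i j (x-of k)) ⌜ 2 ^ n ⌝
    e-ρ1 : ∀ i j α b (m : IsMaxα i j α b)
           → Edge (u i j one b) (v i j h1 α b (proj₁ m)) (⌜ 2 ^ val b ⌝ - fr (val α))
    e-ρ3 : ∀ i j α b (m : IsMinα i j α b)
           → Edge (u i j three b) (v i j h3 α b (proj₁ m)) (⌜ 2 ^ val b ∸ 1 ⌝ + fr (val α))
    e-P-first : ∀ i i' j e (k : Fin n) → toℕ k ≡ 0
                → Edge (x i j h3) (p i i' j e k) (+ 1 / suc n)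
    e-P : ∀ i i' j e (k k' : Fin n) → toℕ k' ≡ suc (toℕ k)
          → Edge (p i i' j e k) (p i i' j e k') (+ 1 / suc n)
    e-P-last : ∀ i i' j e (k : Fin n) → val k ≡ n
               → Edge (p i i' j e k) (x i' j h1) (+ 1 / suc n)
    e-P' : ∀ i j j' e (l l' : Fin n) → toℕ l' ≡ suc (toℕ l)
           → Edge (w i j j' e l) (w i j j' e l') ⌜ 2 ^ val l ⌝
    -- identifications w_1 = x^4_{i,j+1}, w_n = x^2_{i,j} (as length-0 edges)
    e-P'-first : ∀ i j j' e (l : Fin n) → toℕ l ≡ 0
                 → Edge (w i j j' e l) (x i j' h4) 0ℚ
    e-P'-last : ∀ i j j' e (l : Fin n) → val l ≡ n
                → Edge (w i j j' e l) (x i j h2) 0ℚ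

  Adj : Vtx → Vtx → ℚ → Set
  Adj s t ℓ = Edge s t ℓ ⊎ Edge t s ℓ

  data Walk : Vtx → Vtx → ℚ → Set where
    [] : ∀ {s} → Walk s s 0ℚ
    step : ∀ {s t r ℓ m} → Adj s t ℓ → Walk t r m → Walk s r (ℓ + m)

  DistLe : Vtx → Vtx → ℚ → Set
  DistLe s t c = ∃ λ ℓ → Walk s t ℓ × ℓ ≤ c

module Submission where

-- All edge lengths of G_I are multiples of 1/n, up to the lengths 1/(n+1)
-- on the paths P_{i,j}, which we bound by 1/n.  We therefore measure
-- distances in units of 1/n: "Within s t c" says dist(s,t) ≤ c/n, and
-- "Near s t a b" says dist(s,t) ≤ a·2^n + b, i.e. Within s t (cost a b)
-- with cost a b = a·2^n·n + b·n.  Applied to a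
--      segment O^h this walks from any point to z^h.
--   4. Walks concatenate, so distance bounds add up.
--   5. Inside a gadget: dist(z,y) ≤ 2·2^n+1, dist(v,y) ≤ 3·2^n+1, dist(u,y)
--      ≤ 4·2^n+1, dist(x^1,y), dist(x^3,y) ≤ 5·2^n+1 and dist(x^2,y),
--      dist(x^4,y) ≤ 5·2^n+2; a vertex of P_{i,j} reaches x^3_{i,j} within
--      distance 1, and w_λ on P'_{i,j} reaches x^4_{i,j+1} within 2^{λ}-2.
-- Since 2 ≤ 2^n (n ≥ 1) and 2^λ ≤ 2^n, all bounds are at most 6·2^n.

open import Defs
open import Data.Nat as ℕ using (ℕ; zero; suc; _^_; _∸_; z≤n; s≤s)
import Data.Nat.Properties as ℕ
open import Data.Integer as ℤ using (+_)
import Data.Integer.Properties as ℤ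
open import Data.Rational using (ℚ; _/_; _-_; -_; _≤_; _<_; 0ℚ; toℚᵘ)
open import Data.Rational.Properties
  using ( ≤-trans; ≤-reflexive; <-≤-trans; <-irrefl; +-mono-≤; +-monoʳ-≤
        ; +-assoc; +-identityˡ; +-identityʳ; +-inverseʳ; neg-antimono-≤
        ; nonNegative⁻¹; normalize-nonNeg; toℚᵘ-injective; toℚᵘ-fromℚᵘ
        ; toℚᵘ-homo-+; toℚᵘ-cancel-≤; module ≤-Reasoning)
import Data.Rational.Unnormalised as ℚᵘ
import Data.Rational.Unnormalised.Properties as ℚᵘ
open import Data.Fin as Fin using (Fin; toℕ; fromℕ; inject₁)
import Data.Fin.Properties as Finₚ
open import Data.Bool using (Bool; true; _≟_)
open import Data.Product using (∃; ∃₂; _×_; _,_; proj₁; proj₂)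
open import Data.Sum using (inj₁; inj₂)
open import Data.Empty using (⊥-elim)
open import Function using (_∘_)
open import Relation.Nullary using (¬_; Dec; yes; no)
open import Relation.Nullary.Decidable using (_×-dec_; _⊎-dec_; map′)
open import Relation.Unary using (Decidable)
open import Relation.Binary.PropositionalEquality
  using (_≡_; refl; sym; trans; cong; cong₂; subst; subst₂; module ≡-Reasoning)

nonNeg-/ : ∀ a d .{{_ : ℕ.NonZero d}} → 0ℚ ≤ + a / d
nonNeg-/ a d = nonNegative⁻¹ (+ a / d) {{normalize-nonNeg a d}}

sub-nonNeg-≤ : ∀ p q → 0ℚ ≤ q → p - q ≤ p
sub-nonNeg-≤ p q 0≤q =
  ≤-trans (+-monoʳ-≤ p (neg-antimono-≤ 0≤q)) (≤-reflexive (+-identityʳ p))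

module Units (k : ℕ) where
  open import Data.Rational using (_+_)
  open import Data.Integer.Tactic.RingSolver using (solve-∀)

  n : ℕ
  n = suc k

  fr : ℕ → ℚ
  fr c = + c / n

  fr≃ : ∀ c → toℚᵘ (fr c) ℚᵘ.≃ ℚᵘ.mkℚᵘ (+ c) k
  fr≃ c = toℚᵘ-fromℚᵘ (ℚᵘ.mkℚᵘ (+ c) k)

  fr-+ : ∀ a b → fr (a ℕ.+ b) ≡ fr a + fr b
  fr-+ a b = toℚᵘ-injective (ℚᵘ.≃-trans (fr≃ (a ℕ.+ b)) (ℚᵘ.≃-sym
    (ℚᵘ.≃-trans (toℚᵘ-homo-+ (fr a) (fr b))
      (ℚᵘ.≃-trans (ℚᵘ.+-cong (fr≃ a) (fr≃ b)) (ℚᵘ.*≡* cross)))))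
    where
    distrib : ∀ x y m → (x ℤ.* m ℤ.+ y ℤ.* m) ℤ.* m ≡ (x ℤ.+ y) ℤ.* (m ℤ.* m)
    distrib = solve-∀
    cross : (+ a ℤ.* + n ℤ.+ + b ℤ.* + n) ℤ.* + n ≡ + (a ℕ.+ b) ℤ.* (+ n ℤ.* + n)
    cross = trans (distrib (+ a) (+ b) (+ n)) (cong (ℤ._* (+ n ℤ.* + n)) (sym (ℤ.pos-+ a b)))

  fr-0 : fr 0 ≡ 0ℚ
  fr-0 = toℚᵘ-injective (ℚᵘ.≃-trans (fr≃ 0) (ℚᵘ.*≡* refl))

  fr-mono-≤ : ∀ {a b} → a ℕ.≤ b → fr a ≤ fr b
  fr-mono-≤ {a} {b} a≤b = begin
    fr a                 ≡⟨ +-identityʳ (fr a) ⟨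
    fr a + 0ℚ            ≤⟨ +-monoʳ-≤ (fr a) (nonNeg-/ (b ∸ a) n) ⟩
    fr a + fr (b ∸ a)    ≡⟨ fr-+ a (b ∸ a) ⟨
    fr (a ℕ.+ (b ∸ a))   ≡⟨ cong fr (ℕ.m+[n∸m]≡n a≤b) ⟩
    fr b                 ∎
    where open ≤-Reasoning

  fr-cancel-< : ∀ {a b} → fr a < fr b → a ℕ.< b
  fr-cancel-< lt = ℕ.≰⇒> (λ b≤a → <-irrefl refl (<-≤-trans lt (fr-mono-≤ b≤a)))

  fr-∸ : ∀ {a b} → b ℕ.≤ a → fr a - fr b ≡ fr (a ∸ b)
  fr-∸ {a} {b} b≤a = begin
    fr a - fr b                ≡⟨ cong (λ t → fr t - fr b) (ℕ.m∸n+n≡m b≤a) ⟨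
    fr (a ∸ b ℕ.+ b) - fr b    ≡⟨ cong (_- fr b) (fr-+ (a ∸ b) b) ⟩
    fr (a ∸ b) + fr b - fr b   ≡⟨ +-assoc (fr (a ∸ b)) (fr b) (- fr b) ⟩
    fr (a ∸ b) + (fr b - fr b) ≡⟨ cong (λ t → fr (a ∸ b) + t) (+-inverseʳ (fr b)) ⟩
    fr (a ∸ b) + 0ℚ            ≡⟨ +-identityʳ (fr (a ∸ b)) ⟩
    fr (a ∸ b)                 ∎
    where open ≡-Reasoning

  int-fr : ∀ m → + m / 1 ≡ fr (m ℕ.* n)
  int-fr m = toℚᵘ-injective (ℚᵘ.≃-trans (toℚᵘ-fromℚᵘ (ℚᵘ.mkℚᵘ (+ m) 0))
    (ℚᵘ.≃-trans (ℚᵘ.*≡* cross) (ℚᵘ.≃-sym (fr≃ (m ℕ.* n)))))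
    where
    cross : + m ℤ.* + n ≡ + (m ℕ.* n) ℤ.* + 1
    cross = trans (sym (ℤ.pos-* m n)) (sym (ℤ.*-identityʳ (+ (m ℕ.* n))))

  int+fr : ∀ m c → + m / 1 + fr c ≡ fr (m ℕ.* n ℕ.+ c)
  int+fr m c = trans (cong (_+ fr c) (int-fr m)) (sym (fr-+ (m ℕ.* n) c))

  1/[n+1]≤fr1 : + 1 / suc n ≤ fr 1
  1/[n+1]≤fr1 = toℚᵘ-cancel-≤
    (ℚᵘ.≤-respˡ-≃ (ℚᵘ.≃-sym (toℚᵘ-fromℚᵘ (ℚᵘ.mkℚᵘ (+ 1) n)))
      (ℚᵘ.≤-respʳ-≃ (ℚᵘ.≃-sym (fr≃ 1)) (ℚᵘ.*≤* (ℤ.+≤+ (ℕ.n≤1+n (n ℕ.+ 0))))))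

∃-above-zero : ∀ {N} {P : Fin (suc N) → Set} → ∃ P → ¬ P Fin.zero → ∃ (P ∘ Fin.suc)
∃-above-zero (Fin.zero , p0) ¬p0 = ⊥-elim (¬p0 p0)
∃-above-zero (Fin.suc a , pa) _ = a , pa

least : ∀ {N} (P : Fin N → Set) → Decidable P → ∃ P
      → ∃ λ α → P α × (∀ β → P β → toℕ α ℕ.≤ toℕ β)
least {suc N} P P? inhabited with P? Fin.zero
... | yes p0 = Fin.zero , p0 , λ _ _ → z≤n
... | no ¬p0 with least (P ∘ Fin.suc) (P? ∘ Fin.suc) (∃-above-zero inhabited ¬p0)
...   | α , pα , min = Fin.suc α , pα , λ { Fin.zero p0 → ⊥-elim (¬p0 p0)
                                          ; (Fin.suc β) pβ → s≤s (min β pβ) }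

greatest : ∀ {N} (P : Fin N → Set) → Decidable P → ∃ P
         → ∃ λ α → P α × (∀ β → P β → toℕ β ℕ.≤ toℕ α)
greatest {suc N} P P? inhabited with Finₚ.any? (P? ∘ Fin.suc)
... | yes above with greatest (P ∘ Fin.suc) (P? ∘ Fin.suc) above
...   | α , pα , max = Fin.suc α , pα , λ { Fin.zero _ → z≤n
                                          ; (Fin.suc β) pβ → s≤s (max β pβ) }
greatest P P? (Fin.zero , p0) | no none =
  Fin.zero , p0 , λ { Fin.zero _ → z≤n ; (Fin.suc β) pβ → ⊥-elim (none (β , pβ)) }
greatest P P? (Fin.suc a , pa) | no none = ⊥-elim (none (a , pa))

predecessor : ∀ {N m} (κ : Fin (suc N)) → toℕ κ ≡ suc m → ∃ λ (κ' : Fin (suc N)) → toℕ κ' ≡ m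
predecessor (Fin.suc κ) eq = inject₁ κ , trans (Finₚ.toℕ-inject₁ κ) (ℕ.suc-injective eq)

-- Then every two points are connected at cost equal to their key difference:
-- split at an intermediate point until none is left.
module IntervalChain {Pt : Set} (key : Pt → ℕ)
  (between? : ∀ lo hi → Dec (∃ λ t → lo ℕ.< key t × key t ℕ.< hi))
  (R : Pt → Pt → ℕ → Set)
  (R-++ : ∀ {r t q a b} → R r t a → R t q b → R r q (a ℕ.+ b))
  (R-adjacent : ∀ q r → key q ℕ.≤ key r → (∀ t → ¬ (key q ℕ.< key t × key t ℕ.< key r))
              → R r q (key r ∸ key q))
  where

  ∸-split : ∀ {a b c} → a ℕ.≤ b → b ℕ.≤ c → (c ∸ b) ℕ.+ (b ∸ a) ≡ c ∸ a
  ∸-split {a} {b} {c} a≤b b≤c =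
    trans (sym (ℕ.+-∸-assoc (c ∸ b) a≤b)) (cong (_∸ a) (ℕ.m∸n+n≡m b≤c))

  -- recursion on an upper bound f of the key difference, which drops by at
  -- least one at each split
  chain-within : ∀ f q r → key r ∸ key q ℕ.≤ f → key q ℕ.≤ key r → R r q (key r ∸ key q)
  chain-within f q r gap q≤r with between? (key q) (key r)
  ... | no none = R-adjacent q r q≤r (λ t q<t<r → none (t , q<t<r))
  ... | yes (t , q<t , t<r) with f
  ...   | zero = ⊥-elim (ℕ.<⇒≱ (ℕ.m<n⇒0<n∸m (ℕ.<-trans q<t t<r)) gap)
  ...   | suc f' = subst (R r q) (∸-split (ℕ.<⇒≤ q<t) (ℕ.<⇒≤ t<r))
                     (R-++ (chain-within f' t r upper (ℕ.<⇒≤ t<r))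
                           (chain-within f' q t lower (ℕ.<⇒≤ q<t)))
    where
    upper : key r ∸ key t ℕ.≤ f'
    upper = ℕ.≤-pred (ℕ.<-≤-trans (ℕ.∸-monoʳ-< q<t (ℕ.<⇒≤ t<r)) gap)
    lower : key t ∸ key q ℕ.≤ f'
    lower = ℕ.≤-pred (ℕ.<-≤-trans (ℕ.∸-monoˡ-< t<r (ℕ.<⇒≤ q<t)) gap)

  chain : ∀ q r → key q ℕ.≤ key r → R r q (key r ∸ key q)
  chain q r = chain-within (key r ∸ key q) q r ℕ.≤-refl

module WalkAlgebra (I : GTInstance) where
  open import Data.Rational using (_+_)
  open Construction I

  _++ʷ_ : ∀ {s t r ℓ m} → Walk s t ℓ → Walk t r m → Walk s r (ℓ + m)
  [] ++ʷ ω = subst (Walk _ _) (sym (+-identityˡ _)) ω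
  _++ʷ_ {m = m} (step {ℓ = ℓ} {m = ℓ'} e ω) ω' =
    subst (Walk _ _) (sym (+-assoc ℓ ℓ' m)) (step e (ω ++ʷ ω'))

  dist-trans : ∀ {s t r a b} → DistLe s t a → DistLe t r b → DistLe s r (a + b)
  dist-trans (ℓ , ω , ℓ≤a) (m , ω' , m≤b) = ℓ + m , ω ++ʷ ω' , +-mono-≤ ℓ≤a m≤b

  dist-mono : ∀ {s t a b} → DistLe s t a → a ≤ b → DistLe s t b
  dist-mono (ℓ , ω , ℓ≤a) a≤b = ℓ , ω , ≤-trans ℓ≤a a≤b

  dist-edge : ∀ {s t ℓ c} → Adj s t ℓ → ℓ ≤ c → DistLe s t c
  dist-edge {ℓ = ℓ} e ℓ≤c = ℓ + 0ℚ , step e [] , ≤-trans (≤-reflexive (+-identityʳ ℓ)) ℓ≤c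

  dist-refl : ∀ {s c} → 0ℚ ≤ c → DistLe s s c
  dist-refl 0≤c = 0ℚ , [] , 0≤c

module Distances (χ k : ℕ) (S : Fin χ → Fin χ → Fin (suc k) → Fin (suc k) → Bool) where
  open import Data.Rational using (_+_)
  open import Data.Nat.Tactic.RingSolver using (solve-∀)

  I : GTInstance
  I = record { χ = χ ; n = suc k ; S = S }

  open Construction I
  open WalkAlgebra I
  open Units k using (n; fr-+; fr-0; fr-mono-≤; fr-cancel-<; fr-∸; int-fr; int+fr; 1/[n+1]≤fr1)

  -- T = 2^n·n is the number of units in the length 2^n
  T : ℕ
  T = 2 ^ n ℕ.* n

  cost : ℕ → ℕ → ℕ
  cost a b = a ℕ.* T ℕ.+ b ℕ.* n

  cost-+ : ∀ a b c d → cost a b ℕ.+ cost c d ≡ cost (a ℕ.+ c) (b ℕ.+ d)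
  cost-+ a b c d = linear a b c d T n
    where
    linear : ∀ a b c d t m
           → (a ℕ.* t ℕ.+ b ℕ.* m) ℕ.+ (c ℕ.* t ℕ.+ d ℕ.* m) ≡ (a ℕ.+ c) ℕ.* t ℕ.+ (b ℕ.+ d) ℕ.* m
    linear = solve-∀

  cost-mono : ∀ {a a' b b'} → a ℕ.≤ a' → b ℕ.≤ b' → cost a b ℕ.≤ cost a' b'
  cost-mono a≤a' b≤b' = ℕ.+-mono-≤ (ℕ.*-monoˡ-≤ T a≤a') (ℕ.*-monoˡ-≤ n b≤b')

  T≡cost10 : T ≡ cost 1 0
  T≡cost10 = unit T n
    where
    unit : ∀ t m → t ≡ 1 ℕ.* t ℕ.+ 0 ℕ.* m
    unit = solve-∀

  n≡cost01 : n ≡ cost 0 1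
  n≡cost01 = unit T n
    where
    unit : ∀ t m → m ≡ 0 ℕ.* t ℕ.+ 1 ℕ.* m
    unit = solve-∀

  pow-bound : ∀ (b : Fin n) → 2 ^ val b ℕ.≤ 2 ^ n
  pow-bound b = ℕ.^-monoʳ-≤ 2 (Finₚ.toℕ<n b)

  -- 2^{n+1} = 2·2^n is the distance from v^h_{(a,b)} to ψ^h_{(a,b)}
  double : 2 ^ (n ℕ.+ 1) ℕ.* n ≡ cost 2 0
  double = trans (cong (ℕ._* n) (ℕ.^-distribˡ-+-* 2 n 1)) (shape (2 ^ n) n)
    where
    shape : ∀ p m → p ℕ.* 2 ℕ.* m ≡ 2 ℕ.* (p ℕ.* m) ℕ.+ 0 ℕ.* m
    shape = solve-∀

  -- the spokes {y, z^h} have length 2^{n+1} + 1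
  spoke : + (2 ^ (n ℕ.+ 1) ℕ.+ 1) / 1 ≡ fr (cost 2 1)
  spoke = trans (int-fr (2 ^ (n ℕ.+ 1) ℕ.+ 1)) (cong fr
    (trans (cong (λ p → (p ℕ.+ 1) ℕ.* n) (ℕ.^-distribˡ-+-* 2 n 1)) (shape (2 ^ n) n)))
    where
    shape : ∀ p m → (p ℕ.* 2 ℕ.+ 1) ℕ.* m ≡ 2 ℕ.* (p ℕ.* m) ℕ.+ 1 ℕ.* m
    shape = solve-∀

  target : fr (cost 6 0) ≡ + (2 ^ (n ℕ.+ 2) ℕ.+ 2 ^ (n ℕ.+ 1)) / 1
  target = sym (trans (int-fr (2 ^ (n ℕ.+ 2) ℕ.+ 2 ^ (n ℕ.+ 1))) (cong fr
    (trans (cong₂ (λ p q → (p ℕ.+ q) ℕ.* n) (ℕ.^-distribˡ-+-* 2 n 2) (ℕ.^-distribˡ-+-* 2 n 1))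
           (shape (2 ^ n) n))))
    where
    shape : ∀ p m → (p ℕ.* 4 ℕ.+ p ℕ.* 2) ℕ.* m ≡ 6 ℕ.* (p ℕ.* m) ℕ.+ 0 ℕ.* m
    shape = solve-∀

  -- as n ≥ 1 we have 2 ≤ 2^n, hence 5·2^n + 2 ≤ 6·2^n
  budget : cost 5 2 ℕ.≤ cost 6 0
  budget = begin
    5 ℕ.* T ℕ.+ 2 ℕ.* n       ≤⟨ ℕ.+-monoʳ-≤ (5 ℕ.* T) (ℕ.*-monoˡ-≤ n (ℕ.^-monoʳ-≤ 2 (s≤s (z≤n {k})))) ⟩
    5 ℕ.* T ℕ.+ T             ≡⟨ shape T n ⟩
    6 ℕ.* T ℕ.+ 0 ℕ.* n       ∎
    where
    open ℕ.≤-Reasoning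
    shape : ∀ t m → 5 ℕ.* t ℕ.+ t ≡ 6 ℕ.* t ℕ.+ 0 ℕ.* m
    shape = solve-∀

  -- geom m = 2 + 4 + ⋯ + 2^m = 2^{m+1} − 2, the length of w_{m+1} ⋯ w_1
  geom : ℕ → ℕ
  geom zero = 0
  geom (suc m) = 2 ^ suc m ℕ.+ geom m

  geom+2 : ∀ m → geom m ℕ.+ 2 ≡ 2 ^ suc m
  geom+2 zero = refl
  geom+2 (suc m) = begin
    2 ^ suc m ℕ.+ geom m ℕ.+ 2      ≡⟨ ℕ.+-assoc (2 ^ suc m) (geom m) 2 ⟩
    2 ^ suc m ℕ.+ (geom m ℕ.+ 2)    ≡⟨ cong (2 ^ suc m ℕ.+_) (geom+2 m) ⟩
    2 ^ suc m ℕ.+ 2 ^ suc m         ≡⟨ twice (2 ^ suc m) ⟩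
    2 ^ suc (suc m)                 ∎
    where
    open ≡-Reasoning
    twice : ∀ p → p ℕ.+ p ≡ 2 ℕ.* p
    twice = solve-∀

  -- the tightest case: w_{m+1} reaches x^4 within 2^{m+1} − 2 ≤ 2^n − 2
  geom-budget : ∀ m → m ℕ.< n → geom m ℕ.* n ℕ.+ cost 5 2 ℕ.≤ cost 6 0
  geom-budget m m<n = begin
    geom m ℕ.* n ℕ.+ cost 5 2           ≡⟨ shape (geom m) T n ⟩
    (geom m ℕ.+ 2) ℕ.* n ℕ.+ 5 ℕ.* T    ≡⟨ cong (λ g → g ℕ.* n ℕ.+ 5 ℕ.* T) (geom+2 m) ⟩
    2 ^ suc m ℕ.* n ℕ.+ 5 ℕ.* T         ≤⟨ ℕ.+-monoˡ-≤ (5 ℕ.* T) (ℕ.*-monoˡ-≤ n (ℕ.^-monoʳ-≤ 2 m<n)) ⟩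
    T ℕ.+ 5 ℕ.* T                       ≡⟨ shape' T n ⟩
    cost 6 0                            ∎
    where
    open ℕ.≤-Reasoning
    shape : ∀ g t m → g ℕ.* m ℕ.+ (5 ℕ.* t ℕ.+ 2 ℕ.* m) ≡ (g ℕ.+ 2) ℕ.* m ℕ.+ 5 ℕ.* t
    shape = solve-∀
    shape' : ∀ t m → t ℕ.+ 5 ℕ.* t ≡ 6 ℕ.* t ℕ.+ 0 ℕ.* m
    shape' = solve-∀

  -- positions on a segment O^h, in units: d_{(a,b)} and d_{(a,b)} + 2^{n+1}
  Npv : Fin n → Fin n → ℕ
  Npv a b = (2 ^ val b ∸ 1) ℕ.* n ℕ.+ val a

  Nψ : Fin n → Fin n → ℕ
  Nψ a b = Npv a b ℕ.+ 2 ^ (n ℕ.+ 1) ℕ.* n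

  d≡ : ∀ a b → d a b ≡ fr (Npv a b)
  d≡ a b = int+fr (2 ^ val b ∸ 1) (val a)

  ψ≡ : ∀ a b → d a b + + (2 ^ (n ℕ.+ 1)) / 1 ≡ fr (Nψ a b)
  ψ≡ a b = trans (cong₂ _+_ (d≡ a b) (int-fr (2 ^ (n ℕ.+ 1)))) (sym (fr-+ (Npv a b) _))

  Npv≤ : ∀ a b → Npv a b ℕ.≤ cost 1 0
  Npv≤ a b = begin
    (2 ^ val b ∸ 1) ℕ.* n ℕ.+ val a      ≤⟨ ℕ.+-monoʳ-≤ _ (Finₚ.toℕ<n a) ⟩
    (2 ^ val b ∸ 1) ℕ.* n ℕ.+ n          ≡⟨ cong ((2 ^ val b ∸ 1) ℕ.* n ℕ.+_) (ℕ.*-identityˡ n) ⟨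
    (2 ^ val b ∸ 1) ℕ.* n ℕ.+ 1 ℕ.* n    ≡⟨ ℕ.*-distribʳ-+ n (2 ^ val b ∸ 1) 1 ⟨
    (2 ^ val b ∸ 1 ℕ.+ 1) ℕ.* n          ≡⟨ cong (ℕ._* n) (ℕ.m∸n+n≡m (ℕ.m^n>0 2 (val b))) ⟩
    2 ^ val b ℕ.* n                      ≤⟨ ℕ.*-monoˡ-≤ n (pow-bound b) ⟩
    T                                    ≡⟨ T≡cost10 ⟩
    cost 1 0                             ∎
    where open ℕ.≤-Reasoning

  Nψ≤ : ∀ a b → Nψ a b ℕ.≤ cost 3 0
  Nψ≤ a b = ℕ.≤-trans (ℕ.+-mono-≤ (Npv≤ a b) (ℕ.≤-reflexive double)) (ℕ.≤-reflexive (cost-+ 1 0 2 0))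

  Nψ'≤ : ∀ a b → Nψ a b ℕ.+ 1 ℕ.≤ cost 3 1
  Nψ'≤ a b = ℕ.≤-trans (ℕ.+-mono-≤ (Nψ≤ a b) (ℕ.≤-trans (s≤s z≤n) (ℕ.≤-reflexive n≡cost01)))
                       (ℕ.≤-reflexive (cost-+ 3 0 0 1))

  -- dist(s,t) ≤ c/n  (a record, so that c can be inferred from the type)
  record Within (s t : Vtx) (c : ℕ) : Set where
    constructor within
    field distLe : DistLe s t (fr c)

  within-++ : ∀ {s t r a b} → Within s t a → Within t r b → Within s r (a ℕ.+ b)
  within-++ {a = a} {b} (within σ) (within τ) =
    within (dist-mono (dist-trans σ τ) (≤-reflexive (sym (fr-+ a b))))

  within-≤ : ∀ {s t a b} → Within s t a → a ℕ.≤ b → Within s t b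
  within-≤ (within σ) a≤b = within (dist-mono σ (fr-mono-≤ a≤b))

  edge : ∀ {s t ℓ c} → Adj s t ℓ → ℓ ≤ fr c → Within s t c
  edge e ℓ≤c = within (dist-edge e ℓ≤c)

  record Near (s t : Vtx) (a b : ℕ) : Set where
    constructor near
    field within-cost : Within s t (cost a b)
  open Near

  near-++ : ∀ {s t r a b c d} → Near s t a b → Near t r c d → Near s r (a ℕ.+ c) (b ℕ.+ d)
  near-++ {a = a} {b} {c} {d} (near σ) (near τ) = near (subst (Within _ _) (cost-+ a b c d) (within-++ σ τ))

  near-edge : ∀ {s t ℓ a b} → Adj s t ℓ → ℓ ≤ fr (cost a b) → Near s t a b
  near-edge e ℓ≤ = near (edge e ℓ≤)

  near-budget : ∀ {s t a b} → Near s t a b → a ℕ.≤ 5 → b ℕ.≤ 2 → Within s t (cost 6 0)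
  near-budget (near σ) a≤5 b≤2 = within-≤ σ (ℕ.≤-trans (cost-mono a≤5 b≤2) budget)

  int≤2ⁿ : ∀ m → m ℕ.≤ 2 ^ n → + m / 1 ≤ fr (cost 1 0)
  int≤2ⁿ m m≤ = subst₂ _≤_ (sym (int-fr m)) (cong fr T≡cost10) (fr-mono-≤ (ℕ.*-monoˡ-≤ n m≤))

  x2-length : ∀ a b → + (2 ^ n ℕ.+ 2 ^ val b) / 1 + fr (val a) ≤ fr (cost 2 1)
  x2-length a b = subst (_≤ fr (cost 2 1)) (sym (int+fr (2 ^ n ℕ.+ 2 ^ val b) (val a)))
    (fr-mono-≤ (begin
      (2 ^ n ℕ.+ 2 ^ val b) ℕ.* n ℕ.+ val a   ≤⟨ ℕ.+-mono-≤ (ℕ.*-monoˡ-≤ n (ℕ.+-monoʳ-≤ (2 ^ n) (pow-bound b)))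
                                                            (Finₚ.toℕ<n a) ⟩
      (2 ^ n ℕ.+ 2 ^ n) ℕ.* n ℕ.+ n           ≡⟨ shape (2 ^ n) n ⟩
      cost 2 1                                ∎))
    where
    open ℕ.≤-Reasoning
    shape : ∀ p m → (p ℕ.+ p) ℕ.* m ℕ.+ m ≡ 2 ℕ.* (p ℕ.* m) ℕ.+ 1 ℕ.* m
    shape = solve-∀

  module Segment (i j : Fin χ) where

    N : OPt i j → ℕ
    N start = 0
    N end = 2 ^ (n ℕ.+ 2) ℕ.* n ℕ.+ 1
    N (pv a b _) = Npv a b
    N (pψ a b _) = Nψ a b
    N (pψ' a b _) = Nψ a b ℕ.+ 1

    pos≡ : ∀ q → pos q ≡ fr (N q)
    pos≡ start = sym fr-0
    pos≡ end = int+fr (2 ^ (n ℕ.+ 2)) 1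
    pos≡ (pv a b _) = d≡ a b
    pos≡ (pψ a b _) = ψ≡ a b
    pos≡ (pψ' a b _) = trans (cong (_+ fr 1) (ψ≡ a b)) (sym (fr-+ (Nψ a b) 1))

    member-between? : (F : Fin n → Fin n → ℕ) → ∀ lo hi
                    → Dec (∃₂ λ a b → Mem i j a b × lo ℕ.< F a b × F a b ℕ.< hi)
    member-between? F lo hi = Finₚ.any? λ a → Finₚ.any? λ b →
      (S i j a b ≟ true) ×-dec (lo ℕ.<? F a b) ×-dec (F a b ℕ.<? hi)

    between? : ∀ lo hi → Dec (∃ λ t → lo ℕ.< N t × N t ℕ.< hi)
    between? lo hi = map′
      (λ { (inj₁ h) → start , h
         ; (inj₂ (inj₁ h)) → end , h
         ; (inj₂ (inj₂ (inj₁ (a , b , m , h)))) → pv a b m , h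
         ; (inj₂ (inj₂ (inj₂ (inj₁ (a , b , m , h))))) → pψ a b m , h
         ; (inj₂ (inj₂ (inj₂ (inj₂ (a , b , m , h))))) → pψ' a b m , h })
      (λ { (start , h) → inj₁ h
         ; (end , h) → inj₂ (inj₁ h)
         ; (pv a b m , h) → inj₂ (inj₂ (inj₁ (a , b , m , h)))
         ; (pψ a b m , h) → inj₂ (inj₂ (inj₂ (inj₁ (a , b , m , h))))
         ; (pψ' a b m , h) → inj₂ (inj₂ (inj₂ (inj₂ (a , b , m , h)))) })
      (   (lo ℕ.<? 0) ×-dec (0 ℕ.<? hi)
      ⊎-dec (lo ℕ.<? N end) ×-dec (N end ℕ.<? hi)
      ⊎-dec member-between? Npv lo hi
      ⊎-dec member-between? Nψ lo hi
      ⊎-dec member-between? (λ a b → Nψ a b ℕ.+ 1) lo hi)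

    adjacent : ∀ h q r → N q ℕ.≤ N r → (∀ t → ¬ (N q ℕ.< N t × N t ℕ.< N r))
             → Within (onO i j h r) (onO i j h q) (N r ∸ N q)
    adjacent h q r q≤r empty = edge (inj₂ (e-O i j h q r pos≤ no-point)) (≤-reflexive length)
      where
      pos≤ : pos q ≤ pos r
      pos≤ = subst₂ _≤_ (sym (pos≡ q)) (sym (pos≡ r)) (fr-mono-≤ q≤r)
      no-point : ∀ t → ¬ (pos q < pos t × pos t < pos r)
      no-point t (q<t , t<r) = empty t ( fr-cancel-< (subst₂ _<_ (pos≡ q) (pos≡ t) q<t)
                                       , fr-cancel-< (subst₂ _<_ (pos≡ t) (pos≡ r) t<r))
      length : pos r - pos q ≡ fr (N r ∸ N q)
      length = trans (cong₂ _-_ (pos≡ r) (pos≡ q)) (fr-∸ q≤r)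

    to-start : ∀ h q → Within (onO i j h q) (z i j h) (N q)
    to-start h q = IntervalChain.chain N between?
      (λ r q → Within (onO i j h r) (onO i j h q)) within-++ (adjacent h) start q z≤n

  module Gadget (st : Standing I) (i j : Fin χ) where
    open Segment i j

    z-y : ∀ h → Near (z i j h) (y i j) 2 1
    z-y h = near-edge (inj₂ (e-yz i j h)) (≤-reflexive spoke)

    O-y : ∀ h q a b → N q ℕ.≤ cost a b → Near (onO i j h q) (y i j) (a ℕ.+ 2) (b ℕ.+ 1)
    O-y h q a b N≤ = near (subst (Within _ _) (cost-+ a b 2 1)
      (within-≤ (within-++ (to-start h q) (within-cost (z-y h))) (ℕ.+-monoˡ-≤ (cost 2 1) N≤)))

    v-y : ∀ h a b (m : Mem i j a b) → Near (v i j h a b m) (y i j) 3 1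
    v-y h a b m = O-y h (pv a b m) 1 0 (Npv≤ a b)

    ρ1-edge : ∀ α b (max : IsMaxα i j α b) → Near (u i j one b) (v i j h1 α b (proj₁ max)) 1 0
    ρ1-edge α b max = near-edge (inj₁ (e-ρ1 i j α b max))
      (≤-trans (sub-nonNeg-≤ _ _ (nonNeg-/ (val α) n)) (int≤2ⁿ _ (pow-bound b)))

    ρ3-edge : ∀ α b (min : IsMinα i j α b) → Near (u i j three b) (v i j h3 α b (proj₁ min)) 1 0
    ρ3-edge α b min = near-edge (inj₁ (e-ρ3 i j α b min))
      (subst (_≤ fr (cost 1 0)) (sym (d≡ α b)) (fr-mono-≤ (Npv≤ α b)))

    u1-y : ∀ b → Near (u i j one b) (y i j) 4 1
    u1-y b with greatest (λ α → Mem i j α b) (λ α → S i j α b ≟ true) (st i j b)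
    ... | α , mα , max = near-++ (ρ1-edge α b (mα , max)) (v-y h1 α b mα)

    u3-y : ∀ b → Near (u i j three b) (y i j) 4 1
    u3-y b with least (λ α → Mem i j α b) (λ α → S i j α b ≟ true) (st i j b)
    ... | α , mα , min = near-++ (ρ3-edge α b (mα , min)) (v-y h3 α b mα)

    U-edge : ∀ κ → Near (x i j (x-of κ)) (u i j κ (fromℕ k)) 1 0
    U-edge κ = near-edge (inj₂ (e-Ux i j κ (fromℕ k) (cong suc (Finₚ.toℕ-fromℕ k)))) (int≤2ⁿ _ ℕ.≤-refl)

    x1-y : Near (x i j h1) (y i j) 5 1
    x1-y = near-++ (U-edge one) (u1-y (fromℕ k))

    x3-y : Near (x i j h3) (y i j) 5 1
    x3-y = near-++ (U-edge three) (u3-y (fromℕ k))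

    lex-min : ∃₂ λ a b → IsMinS i j a b
    lex-min with least (λ a → ∃ (Mem i j a)) (λ a → Finₚ.any? λ b → S i j a b ≟ true)
                       (proj₁ (st i j Fin.zero) , Fin.zero , proj₂ (st i j Fin.zero))
    ... | a , (b₀ , m₀) , a-min with least (Mem i j a) (λ b → S i j a b ≟ true) (b₀ , m₀)
    ...   | b , m , b-min = a , b , m , lex
      where
      lex : ∀ a' b' → Mem i j a' b' → LexLe a b a' b'
      lex a' b' m' with ℕ.m≤n⇒m<n∨m≡n (a-min a' (b' , m'))
      ... | inj₁ a<a' = inj₁ a<a'
      ... | inj₂ a≡a' with Finₚ.toℕ-injective a≡a'
      ...   | refl = inj₂ (refl , b-min b' m')

    x2-edge : ∀ a b (min : IsMinS i j a b) → Near (x i j h2) (v i j h2 a b (proj₁ min)) 2 1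
    x2-edge a b min = near-edge (inj₁ (e-x2 i j a b min)) (x2-length a b)

    x4-edge : ∀ a b (min : IsMinS i j a b) → Near (x i j h4) (v i j h4 a b (proj₁ min)) 2 1
    x4-edge a b min = near-edge (inj₁ (e-x4 i j a b min))
      (≤-trans (sub-nonNeg-≤ _ _ (nonNeg-/ (val a) n))
               (≤-trans (sub-nonNeg-≤ _ _ (nonNeg-/ (2 ^ val b) 1)) (≤-reflexive spoke)))

    x2-y : Near (x i j h2) (y i j) 5 2
    x2-y with lex-min
    ... | a , b , min = near-++ (x2-edge a b min) (v-y h2 a b (proj₁ min))

    x4-y : Near (x i j h4) (y i j) 5 2
    x4-y with lex-min
    ... | a , b , min = near-++ (x4-edge a b min) (v-y h4 a b (proj₁ min))

  p-to-x3 : ∀ {i i' j e} m (κ : Fin n) → toℕ κ ≡ m → Within (p i i' j e κ) (x i j h3) (suc m)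
  p-to-x3 {i} {i'} {j} {e} zero κ κ≡0 = edge (inj₂ (e-P-first i i' j e κ κ≡0)) 1/[n+1]≤fr1
  p-to-x3 {i} {i'} {j} {e} (suc m) κ κ≡ with predecessor κ κ≡
  ... | κ' , κ'≡ =
    within-++ (edge {c = 1} (inj₂ (e-P i i' j e κ' κ (trans κ≡ (cong suc (sym κ'≡))))) 1/[n+1]≤fr1)
              (p-to-x3 m κ' κ'≡)

  w-to-x4 : ∀ {i j j' e} m (l : Fin n) → toℕ l ≡ m → Within (w i j j' e l) (x i j' h4) (geom m ℕ.* n)
  w-to-x4 {i} {j} {j'} {e} zero l l≡0 = edge (inj₁ (e-P'-first i j j' e l l≡0)) (≤-reflexive (sym fr-0))
  w-to-x4 {i} {j} {j'} {e} (suc m) l l≡ with predecessor l l≡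
  ... | l' , l'≡ = subst (Within _ _) (sym (ℕ.*-distribʳ-+ n (2 ^ suc m) (geom m)))
    (within-++ (edge (inj₂ (e-P' i j j' e l' l (trans l≡ (cong suc (sym l'≡))))) length) (w-to-x4 m l' l'≡))
    where
    length : + (2 ^ val l') / 1 ≤ fr (2 ^ suc m ℕ.* n)
    length = ≤-reflexive (trans (int-fr (2 ^ val l')) (cong (λ t → fr (2 ^ suc t ℕ.* n)) l'≡))

  module Centres (st : Standing I) where
    open Gadget st

    p-y : ∀ i i' j e κ → Near (p i i' j e κ) (y i j) 5 2
    p-y i i' j e κ = near (within-≤ (within-++ (p-to-x3 (toℕ κ) κ refl) (within-cost (x3-y i j)))
      (ℕ.≤-trans (ℕ.+-monoˡ-≤ (cost 5 1) (ℕ.≤-trans (Finₚ.toℕ<n κ) (ℕ.≤-reflexive n≡cost01)))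
                 (ℕ.≤-reflexive (cost-+ 0 1 5 1))))

    -- w_l on P'_{i,j}: the only case that uses the full budget 6·2^n
    w-y : ∀ i j j' e l → Within (w i j j' e l) (y i j') (cost 6 0)
    w-y i j j' e l = within-≤ (within-++ (w-to-x4 (toℕ l) l refl) (within-cost (x4-y i j')))
                              (geom-budget (toℕ l) (Finₚ.toℕ<n l))

    near-centre : (s : Vtx) → ∃₂ λ i j → Within s (y i j) (cost 6 0)
    near-centre (y i j) = i , j , within (dist-refl (nonNeg-/ (cost 6 0) n))
    near-centre (z i j h) = i , j , near-budget (z-y i j h) (ℕ.m≤n+m 2 3) (ℕ.n≤1+n 1)
    near-centre (x i j h1) = i , j , near-budget (x1-y i j) ℕ.≤-refl (ℕ.n≤1+n 1)
    near-centre (x i j h2) = i , j , near-budget (x2-y i j) ℕ.≤-refl ℕ.≤-refl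
    near-centre (x i j h3) = i , j , near-budget (x3-y i j) ℕ.≤-refl (ℕ.n≤1+n 1)
    near-centre (x i j h4) = i , j , near-budget (x4-y i j) ℕ.≤-refl ℕ.≤-refl
    near-centre (v i j h a b m) = i , j , near-budget (v-y i j h a b m) (ℕ.m≤n+m 3 2) (ℕ.n≤1+n 1)
    near-centre (ψ i j h a b m) =
      i , j , near-budget (O-y i j h (pψ a b m) 3 0 (Nψ≤ a b)) ℕ.≤-refl (ℕ.n≤1+n 1)
    near-centre (ψ' i j h a b m) =
      i , j , near-budget (O-y i j h (pψ' a b m) 3 1 (Nψ'≤ a b)) ℕ.≤-refl ℕ.≤-refl
    near-centre (u i j one b) = i , j , near-budget (u1-y i j b) (ℕ.n≤1+n 4) (ℕ.n≤1+n 1)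
    near-centre (u i j three b) = i , j , near-budget (u3-y i j b) (ℕ.n≤1+n 4) (ℕ.n≤1+n 1)
    near-centre (p i i' j e κ) = i , j , near-budget (p-y i i' j e κ) ℕ.≤-refl ℕ.≤-refl
    near-centre (w i j j' e l) = i , j' , w-y i j j' e l

    nearest-centre : (s : Vtx) → ∃₂ λ i j → DistLe s (y i j) ⌜ 2 ^ (n ℕ.+ 2) ℕ.+ 2 ^ (n ℕ.+ 1) ⌝
    nearest-centre s with near-centre s
    ... | i , j , within σ = i , j , dist-mono σ (≤-reflexive target)

open import Data.Nat using (_^_; _+_)

lemma6 : (I : GTInstance) → Standing I → (s : Construction.Vtx I)
    → ∃₂ λ i j → Construction.DistLe I s (Construction.Vtx.y i j)
        (Construction.⌜_⌝ I (2 ^ (GTInstance.n I + 2) + 2 ^ (GTInstance.n I + 1)))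
lemma6 record { χ = χ ; n = suc k ; S = S } = Distances.Centres.nearest-centre χ k S
lemma6 record { n = zero ; n≢0 = record { nonZero = () } }
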